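{- Let $M=\prod_{i=1}^K p_i^{n_i}$ with distinct primes $p_i$ and $n_i\ge1$, let $\Delta$ be an $M$-cuboid with vertices $x_\epsilon$, $\epsilon\in\{0,1\}^K$, and let $f:\mathbb{Z}_M\to\mathbb{R}$ be a step function. Suppose there exist $i\in\{1,\dots,K\}$ and $\beta\le n_i-1$ such that $\gcd(x_\epsilon,p_i^{n_i})=p_i^\beta$ for all vertices $x_\epsilon$ of $\Delta$. Then for any pair of vertices $x_\epsilon,x_{\epsilon'}$ of $\Delta$ with $\gcd(x_\epsilon-x_{\epsilon'},M)=M/p_i$ we have $f(x_\epsilon)=f(x_{\epsilon'})$. Moreover, if $\gcd(x_\epsilon,p_i^{n_i})=p_i^\beta$ with $\beta\le n_i-2$ holds for one single vertex of $\Delta$, then it holds for all vertices of $\Delta$ with the same exponent $\beta$, and hence $f(x_\epsilon)=f(x_{\epsilon'})$ for every pair of vertices with $\gcd(x_\epsilon-x_{\epsilon'},M)=M/p_i$.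
   Context: For $m\mid M$, $R_m=\{z\in\mathbb{Z}_M:\gcd(z,M)=m\}$; $f$ is a step function if constant on each $R_m$. An $M$-cuboid is determined by $c\in\mathbb{Z}_M$ and $d_i=\rho_iM/p_i$ with $\rho_i\in\{1,\dots,p_i-1\}$ ($i=1,\dots,K$) (its mask polynomial is $X^c\prod_i(1-X^{d_i})$); its vertices are $x_\epsilon=c+\sum_{j=1}^K\epsilon_jd_j \pmod M$ for $\epsilon\in\{0,1\}^K$. Elements of $\mathbb{Z}_M$ are identified with representatives in $\{0,\dots,M-1\}$ when taking gcd's. -}

module Defs where

open import Data.Nat using (ℕ; zero; suc; _+_; _*_; _∸_; _^_; _≤_; _<_; _%_; _/_)
open import Data.Nat.GCD using (gcd)
open import Data.Nat.Primality using (Prime)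
open import Data.Bool using (Bool; true; false)
open import Data.Fin using (Fin)
open import Data.List using (List; map; allFin)
open import Data.Nat.ListAction using (sum; product)
open import Function.Definitions using (Injective)
open import Relation.Binary.PropositionalEquality using (_≡_)

-- reduction modulo m (only used with m ≠ 0; the m = 0 clause is a dummy)
_mod_ : ℕ → ℕ → ℕ
a mod zero = a
a mod suc m = a % suc m

-- exact quotient (only used with m ≠ 0)
_div_ : ℕ → ℕ → ℕ
a div zero = zero
a div suc m = a / suc m

modulus : (K : ℕ) → (Fin K → ℕ) → (Fin K → ℕ) → ℕ
modulus K p n = product (map (λ i → p i ^ n i) (allFin K))

record PrimeData (K : ℕ) : Set where
  field
    p       : Fin K → ℕ
    n       : Fin K → ℕ
    p-prime : ∀ i → Prime (p i)
    p-inj   : Injective _≡_ _≡_ p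
    n-pos   : ∀ i → 1 ≤ n i
  M : ℕ
  M = modulus K p n

-- residues of ℤ_M represented by {0,…,M-1}
-- step function: constant on each R_m = {z : gcd(z,M) = m}
IsStep : {A : Set} → ℕ → (ℕ → A) → Set
IsStep M f = ∀ z z' → z < M → z' < M → gcd z M ≡ gcd z' M → f z ≡ f z'

record Cuboid {K : ℕ} (P : PrimeData K) : Set where
  open PrimeData P
  field
    c     : ℕ
    c<M   : c < M
    ρ     : Fin K → ℕ
    ρ-pos : ∀ i → 1 ≤ ρ i
    ρ<p   : ∀ i → ρ i < p i
  d : Fin K → ℕ
  d i = ρ i * (M div p i)
  vertex : (Fin K → Bool) → ℕ
  vertex ε = (c + sum (map (λ j → bit (ε j) * d j) (allFin K))) mod M
    where
    bit : Bool → ℕ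
    bit true = 1
    bit false = 0

-- the representative of x - y in ℤ_M (for x, y < M)
diffMod : ℕ → ℕ → ℕ → ℕ
diffMod M x y = ((x + M) ∸ y) mod M

{-# OPTIONS --safe #-}
module Submission where

open import Defs
open import Data.Nat using (ℕ; _+_; _^_; _≤_)
open import Data.Nat.GCD using (gcd)
open import Data.Bool using (Bool)
open import Data.Fin using (Fin)
open import Data.Product using (_×_)
open import Relation.Binary.PropositionalEquality using (_≡_)

open import Data.Bool using (true; false)
open import Data.Fin using (_≟_)
open import Data.List using (List; []; _∷_; map; allFin)
open import Data.List.Properties using (map-cong-local)
open import Data.List.Membership.Propositional.Properties using (∈-map⁺; ∈-allFin)
open import Data.List.Relation.Unary.All using (All; []; _∷_)
import Data.List.Relation.Unary.All.Properties as All
open import Data.List.Relation.Unary.AllPairs using (AllPairs; []; _∷_)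
import Data.List.Relation.Unary.AllPairs.Properties as AllPairs
open import Data.Nat using (zero; suc; _*_; _∸_; _<_; _%_; _/_; z≤n; s≤s)
open import Data.Nat.Base using (nonTrivial⇒n>1; nonTrivial⇒≢1)
open import Data.Nat.Properties
  using (*-comm; *-identityˡ; *-identityʳ; +-comm; +-identityʳ; m+[n∸m]≡n; ≤-trans; <-trans; <⇒≤; <⇒≱;
         n<1+n; n≤1+n; m≤n+m; ^-monoʳ-<; m^n≢0)
open import Data.Nat.Divisibility
open import Data.Nat.DivMod using (m%n<n; m/n*n≡m; m≡m%n+[m/n]*n)
open import Data.Nat.GCD using (gcd[m,n]∣m; gcd[m,n]∣n; gcd-greatest; gcd-zeroʳ; c*gcd[m,n]≡gcd[cm,cn])
open import Data.Nat.LCM using (lcm; lcm-least; gcd*lcm)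
open import Data.Nat.Coprimality as Coprimality using (Coprime; coprime-divisor; coprime⇒gcd≡1)
open import Data.Nat.Primality using (Prime; prime⇒irreducible; prime⇒nonZero; prime⇒nonTrivial)
open import Data.Nat.ListAction using (sum; product)
open import Data.Nat.ListAction.Properties using (∈⇒∣product)
open import Data.Product using (_,_)
open import Data.Sum using (inj₁; inj₂; [_,_]′)
open import Function using (_∘_)
open import Relation.Nullary using (¬_; yes; no; contradiction)
open import Relation.Binary.PropositionalEquality
  using (_≢_; refl; sym; trans; cong; subst; subst₂; module ≡-Reasoning)

-- Write M = ∏ q_j with q_j = p_j ^ n_j pairwise coprime, so that gcd (x, M) = ∏ gcd (x, q_j).
-- If gcd (x - y, M) = M / p_i, every q_j with j ≠ i divides x - y, hence gcd (x, q_j) =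
-- gcd (y, q_j); with the hypothesis for q_i this gives gcd (x, M) = gcd (y, M), which is all a
-- step function sees.
-- Every edge d_j is divisible by p_i ^ (n_i - 1), so all vertices have the same gcd with
-- p_i ^ (β + 1) when β ≤ n_i - 2; and gcd (x, p ^ (β + 1)) = p ^ β forces gcd (x, p ^ n) = p ^ β
-- for every n > β.

^-monoʳ-∣ : ∀ a {m n} → m ≤ n → a ^ m ∣ a ^ n
^-monoʳ-∣ a {n = n} z≤n = 1∣ (a ^ n)
^-monoʳ-∣ a (s≤s m≤n) = *-monoʳ-∣ a (^-monoʳ-∣ a m≤n)

p^[1+n]∤p^n : ∀ {p} → Prime p → ∀ n → ¬ (p ^ suc n ∣ p ^ n)
p^[1+n]∤p^n {p} pp n p^[1+n]∣p^n =
  <⇒≱ (^-monoʳ-< p (nonTrivial⇒n>1 p {{prime⇒nonTrivial pp}}) (n<1+n n))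
      (∣⇒≤ {{m^n≢0 p n {{prime⇒nonZero pp}}}} p^[1+n]∣p^n)

∤⇒coprime : ∀ {p d} → Prime p → ¬ (p ∣ d) → Coprime p d
∤⇒coprime pp p∤d (e∣p , e∣d) with prime⇒irreducible pp e∣p
... | inj₁ e≡1  = e≡1
... | inj₂ refl = contradiction e∣d p∤d

prime≢⇒coprime : ∀ {p q} → Prime p → Prime q → p ≢ q → Coprime p q
prime≢⇒coprime pp pq p≢q =
  ∤⇒coprime pp λ p∣q → [ nonTrivial⇒≢1 {{prime⇒nonTrivial pp}} , p≢q ]′ (prime⇒irreducible pq p∣q)

∣p^n∧p^[1+k]∤⇒∣p^k : ∀ {p} → Prime p → ∀ n k {d} → d ∣ p ^ n → ¬ (p ^ suc k ∣ d) → d ∣ p ^ k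
∣p^n∧p^[1+k]∤⇒∣p^k {p} pp zero    k d∣1 _ = ∣-trans d∣1 (1∣ (p ^ k))
∣p^n∧p^[1+k]∤⇒∣p^k {p} pp (suc n) k {d} d∣p^[1+n] p^[1+k]∤d with p ∣? d
... | no p∤d = ∣p^n∧p^[1+k]∤⇒∣p^k pp n k
                 (coprime-divisor (Coprimality.sym (∤⇒coprime pp p∤d)) d∣p^[1+n]) p^[1+k]∤d
... | yes (divides e refl) with k
...   | zero  = contradiction (∣-trans (∣-reflexive (*-identityʳ p)) (n∣m*n e)) p^[1+k]∤d
...   | suc k = subst (e * p ∣_) (*-comm (p ^ k) p) (*-monoˡ-∣ p e∣p^k)
  where
  e∣p^k : e ∣ p ^ k
  e∣p^k = ∣p^n∧p^[1+k]∤⇒∣p^k pp n k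
    (*-cancelʳ-∣ p {{prime⇒nonZero pp}} (subst (e * p ∣_) (*-comm p (p ^ n)) d∣p^[1+n]))
    (λ p^[1+k]∣e → p^[1+k]∤d (subst (_∣ e * p) (*-comm (p ^ suc k) p) (*-monoˡ-∣ p p^[1+k]∣e)))

coprime-* : ∀ {a b c} → Coprime a b → Coprime a c → Coprime a (b * c)
coprime-* a⊥b a⊥c (d∣a , d∣bc) =
  a⊥c (d∣a , coprime-divisor (λ (e∣d , e∣b) → a⊥b (∣-trans e∣d d∣a , e∣b)) d∣bc)

coprime-^ : ∀ {a b} k → Coprime a b → Coprime a (b ^ k)
coprime-^ zero    a⊥b (_ , d∣1) = ∣1⇒≡1 d∣1
coprime-^ (suc k) a⊥b = coprime-* a⊥b (coprime-^ k a⊥b)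

coprime-^-^ : ∀ {a b} j k → Coprime a b → Coprime (a ^ j) (b ^ k)
coprime-^-^ j k a⊥b = Coprimality.sym (coprime-^ j (Coprimality.sym (coprime-^ k a⊥b)))

coprime-product : ∀ {a bs} → All (Coprime a) bs → Coprime a (product bs)
coprime-product []           (_ , d∣1) = ∣1⇒≡1 d∣1
coprime-product (a⊥b ∷ a⊥bs) = coprime-* a⊥b (coprime-product a⊥bs)

coprime⇒lcm≡* : ∀ {a b} → Coprime a b → lcm a b ≡ a * b
coprime⇒lcm≡* {a} {b} a⊥b = begin
  lcm a b           ≡⟨ *-identityˡ (lcm a b) ⟨
  1 * lcm a b       ≡⟨ cong (_* lcm a b) (coprime⇒gcd≡1 a⊥b) ⟨
  gcd a b * lcm a b ≡⟨ gcd*lcm a b ⟩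
  a * b             ∎
  where open ≡-Reasoning

gcd[x,a*b]≡gcd[x,a]*gcd[x,b] : ∀ x {a b} → Coprime a b → gcd x (a * b) ≡ gcd x a * gcd x b
gcd[x,a*b]≡gcd[x,a]*gcd[x,b] x {a} {b} a⊥b = ∣-antisym g∣uv uv∣g
  where
  g u v : ℕ
  g = gcd x (a * b)
  u = gcd x a
  v = gcd x b
  g∣x : g ∣ x
  g∣x = gcd[m,n]∣m x (a * b)
  g∣ba : g ∣ b * a
  g∣ba = subst (g ∣_) (*-comm a b) (gcd[m,n]∣n x (a * b))
  g∣bu : g ∣ b * u
  g∣bu = subst (g ∣_) (sym (c*gcd[m,n]≡gcd[cm,cn] b x a)) (gcd-greatest (∣n⇒∣m*n b g∣x) g∣ba)
  g∣uv : g ∣ u * v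
  g∣uv = subst (g ∣_) (sym (c*gcd[m,n]≡gcd[cm,cn] u x b))
           (gcd-greatest (∣n⇒∣m*n u g∣x) (subst (g ∣_) (*-comm b u) g∣bu))
  u⊥v : Coprime u v
  u⊥v (d∣u , d∣v) = a⊥b (∣-trans d∣u (gcd[m,n]∣n x a) , ∣-trans d∣v (gcd[m,n]∣n x b))
  uv∣x : u * v ∣ x
  uv∣x = subst (_∣ x) (coprime⇒lcm≡* u⊥v) (lcm-least (gcd[m,n]∣m x a) (gcd[m,n]∣m x b))
  uv∣g : u * v ∣ g
  uv∣g = gcd-greatest uv∣x (*-pres-∣ (gcd[m,n]∣n x a) (gcd[m,n]∣n x b))

gcd-product : ∀ x {qs} → AllPairs Coprime qs → gcd x (product qs) ≡ product (map (gcd x) qs)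
gcd-product x []                    = gcd-zeroʳ x
gcd-product x {q ∷ qs} (q⊥qs ∷ qs⊥) = begin
  gcd x (q * product qs)             ≡⟨ gcd[x,a*b]≡gcd[x,a]*gcd[x,b] x (coprime-product q⊥qs) ⟩
  gcd x q * gcd x (product qs)       ≡⟨ cong (gcd x q *_) (gcd-product x qs⊥) ⟩
  gcd x q * product (map (gcd x) qs) ∎
  where open ≡-Reasoning

gcd-+-∣ : ∀ x {k m} → m ∣ k → gcd (x + k) m ≡ gcd x m
gcd-+-∣ x {k} {m} m∣k = ∣-antisym
  (gcd-greatest (∣x+k∣k⇒∣x (gcd[m,n]∣m (x + k) m) (∣-trans (gcd[m,n]∣n (x + k) m) m∣k))
                (gcd[m,n]∣n (x + k) m))
  (gcd-greatest (∣m∣n⇒∣m+n (gcd[m,n]∣m x m) (∣-trans (gcd[m,n]∣n x m) m∣k))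
                (gcd[m,n]∣n x m))
  where
  ∣x+k∣k⇒∣x : ∀ {d} → d ∣ x + k → d ∣ k → d ∣ x
  ∣x+k∣k⇒∣x {d} d∣x+k = ∣m+n∣m⇒∣n (subst (d ∣_) (+-comm x k) d∣x+k)

gcd[x,n]∣m⇒gcd[x,m]≡gcd[x,n] : ∀ x {m n} → m ∣ n → gcd x n ∣ m → gcd x m ≡ gcd x n
gcd[x,n]∣m⇒gcd[x,m]≡gcd[x,n] x {m} {n} m∣n gcd[x,n]∣m = ∣-antisym
  (gcd-greatest (gcd[m,n]∣m x m) (∣-trans (gcd[m,n]∣n x m) m∣n))
  (gcd-greatest (gcd[m,n]∣m x n) gcd[x,n]∣m)

gcd[x,p^[1+β]]≡p^β⇒gcd[x,p^n]≡p^β : ∀ {p} → Prime p → ∀ x {β n} → β < n →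
  gcd x (p ^ suc β) ≡ p ^ β → gcd x (p ^ n) ≡ p ^ β
gcd[x,p^[1+β]]≡p^β⇒gcd[x,p^n]≡p^β {p} pp x {β} {n} β<n gcd≡p^β = ∣-antisym g∣p^β p^β∣g
  where
  g : ℕ
  g = gcd x (p ^ n)
  p^β∣x : p ^ β ∣ x
  p^β∣x = subst (_∣ x) gcd≡p^β (gcd[m,n]∣m x (p ^ suc β))
  p^β∣g : p ^ β ∣ g
  p^β∣g = gcd-greatest p^β∣x (^-monoʳ-∣ p (<⇒≤ β<n))
  p^[1+β]∤g : ¬ (p ^ suc β ∣ g)
  p^[1+β]∤g p^[1+β]∣g = p^[1+n]∤p^n pp β (subst (p ^ suc β ∣_) gcd≡p^β
    (gcd-greatest (∣-trans p^[1+β]∣g (gcd[m,n]∣m x (p ^ n))) ∣-refl))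
  g∣p^β : g ∣ p ^ β
  g∣p^β = ∣p^n∧p^[1+k]∤⇒∣p^k pp n β (gcd[m,n]∣n x (p ^ n)) p^[1+β]∤g

m-mod-n<n : ∀ m {n} → 0 < n → m mod n < n
m-mod-n<n m {suc n} _ = m%n<n m (suc n)

∣n∣m-mod-n⇒∣m : ∀ {d m n} → d ∣ n → d ∣ m mod n → d ∣ m
∣n∣m-mod-n⇒∣m {n = zero}  _   d∣m       = d∣m
∣n∣m-mod-n⇒∣m {n = suc _} d∣n d∣m%n = ∣n∣m%n⇒∣m d∣n d∣m%n

gcd-mod-∣ : ∀ x {m n} → m ∣ n → gcd (x mod n) m ≡ gcd x m
gcd-mod-∣ x {n = zero}  _   = refl
gcd-mod-∣ x {m} {n@(suc _)} m∣n = begin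
  gcd (x % n) m             ≡⟨ gcd-+-∣ (x % n) (∣n⇒∣m*n (x / n) m∣n) ⟨
  gcd (x % n + x / n * n) m ≡⟨ cong (λ y → gcd y m) (m≡m%n+[m/n]*n x n) ⟨
  gcd x m                   ∎
  where open ≡-Reasoning

gcd-diffMod-∣ : ∀ {m n x y} → m ∣ n → y ≤ x + n → m ∣ diffMod n x y → gcd x m ≡ gcd y m
gcd-diffMod-∣ {m} {n} {x} {y} m∣n y≤x+n m∣diff = begin
  gcd x m                 ≡⟨ gcd-+-∣ x m∣n ⟨
  gcd (x + n) m           ≡⟨ cong (λ z → gcd z m) (m+[n∸m]≡n y≤x+n) ⟨
  gcd (y + (x + n ∸ y)) m ≡⟨ gcd-+-∣ y (∣n∣m-mod-n⇒∣m m∣n m∣diff) ⟩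
  gcd y m                 ∎
  where open ≡-Reasoning

m-div-n*n≡m : ∀ {m n} → n ∣ m → m div n * n ≡ m
m-div-n*n≡m {n = zero}  0∣m = sym (0∣⇒≡0 0∣m)
m-div-n*n≡m {n = suc _} n∣m = m/n*n≡m n∣m

coprime-∣-div : ∀ {q m p} → q ∣ m → Coprime q p → p ∣ m → q ∣ m div p
coprime-∣-div {q} {m} {p} q∣m q⊥p p∣m =
  coprime-divisor q⊥p (subst (q ∣_) (trans (sym (m-div-n*n≡m p∣m)) (*-comm (m div p) p)) q∣m)

p^[1+k]∣m⇒p^k∣m-div-p : ∀ {p m} k → Prime p → p ^ suc k ∣ m → p ^ k ∣ m div p
p^[1+k]∣m⇒p^k∣m-div-p {p} {m} k pp p^[1+k]∣m = *-cancelʳ-∣ {p ^ k} {m div p} p {{prime⇒nonZero pp}}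
  (subst₂ _∣_ (*-comm p (p ^ k)) (sym (m-div-n*n≡m (∣-trans (m∣m*n {p} (p ^ k)) p^[1+k]∣m))) p^[1+k]∣m)

∣-sum-map : ∀ {A : Set} {d} {f : A → ℕ} xs → (∀ x → d ∣ f x) → d ∣ sum (map f xs)
∣-sum-map []       _   = _ ∣0
∣-sum-map (x ∷ xs) d∣f = ∣m∣n⇒∣m+n (d∣f x) (∣-sum-map xs d∣f)

module PrimeDataProperties {K} (P : PrimeData K) where
  open PrimeData P

  p^n∣M : ∀ j → p j ^ n j ∣ M
  p^n∣M j = ∈⇒∣product (∈-map⁺ (λ j → p j ^ n j) (∈-allFin j))

  p∣M : ∀ j → p j ∣ M
  p∣M j = ∣-trans (∣-reflexive (sym (*-identityʳ (p j)))) (∣-trans (^-monoʳ-∣ (p j) (n-pos j)) (p^n∣M j))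

  p^a⊥p^b : ∀ {i j} a b → i ≢ j → Coprime (p i ^ a) (p j ^ b)
  p^a⊥p^b a b i≢j = coprime-^-^ a b (prime≢⇒coprime (p-prime _) (p-prime _) (i≢j ∘ p-inj))

  p^n∣M-div-p : ∀ {i j} → i ≢ j → p i ^ n i ∣ M div p j
  p^n∣M-div-p {i} {j} i≢j = coprime-∣-div (p^n∣M i)
    (subst (Coprime (p i ^ n i)) (*-identityʳ (p j)) (p^a⊥p^b (n i) 1 i≢j)) (p∣M j)

  p^k∣M-div-p : ∀ {i k} → k < n i → ∀ j → p i ^ k ∣ M div p j
  p^k∣M-div-p {i} {k} k<n j with j ≟ i
  ... | yes refl = p^[1+k]∣m⇒p^k∣m-div-p k (p-prime i) (∣-trans (^-monoʳ-∣ (p i) k<n) (p^n∣M i))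
  ... | no j≢i   = ∣-trans (^-monoʳ-∣ (p i) (<⇒≤ k<n)) (p^n∣M-div-p (j≢i ∘ sym))

  gcd-M-cong : ∀ {i x y} → y ≤ x + M → gcd x (p i ^ n i) ≡ gcd y (p i ^ n i) →
               M div p i ∣ diffMod M x y → gcd x M ≡ gcd y M
  gcd-M-cong {i} {x} {y} y≤x+M gcd≡ᵢ M/p∣diff = begin
    gcd x M                  ≡⟨ gcd-product x pairwise ⟩
    product (map (gcd x) qs) ≡⟨ cong product (map-cong-local (All.map⁺ (All.tabulate⁺ gcd≡))) ⟩
    product (map (gcd y) qs) ≡⟨ gcd-product y pairwise ⟨
    gcd y M                  ∎
    where
    open ≡-Reasoning
    qs : List ℕ
    qs = map (λ j → p j ^ n j) (allFin K)
    pairwise : AllPairs Coprime qs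
    pairwise = AllPairs.map⁺ (AllPairs.tabulate⁺ λ {i} {j} → p^a⊥p^b (n i) (n j))
    gcd≡ : ∀ j → gcd x (p j ^ n j) ≡ gcd y (p j ^ n j)
    gcd≡ j with j ≟ i
    ... | yes refl = gcd≡ᵢ
    ... | no j≢i   = gcd-diffMod-∣ (p^n∣M j) y≤x+M (∣-trans (p^n∣M-div-p j≢i) M/p∣diff)

module CuboidProperties {K} {P : PrimeData K} (Δ : Cuboid P) where
  open PrimeData P
  open Cuboid Δ
  open PrimeDataProperties P

  vertex<M : ∀ ε → vertex ε < M
  vertex<M ε = m-mod-n<n _ (≤-trans (s≤s z≤n) c<M)

  gcd-vertex≡gcd-c : ∀ {r} → r ∣ M → (∀ j → r ∣ M div p j) → ∀ ε → gcd (vertex ε) r ≡ gcd c r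
  gcd-vertex≡gcd-c {r} r∣M r∣M/p ε =
    trans (cong (λ x → gcd x r) vertex≡) (trans (gcd-mod-∣ _ r∣M) (gcd-+-∣ c (∣-sum-map (allFin K) r∣summand)))
    where
    -- The 0/1 coefficient of d j in `vertex` is local to Defs; `summand` is named by
    -- unification with `vertex≡`, so that its value can be split on ε j.
    summand : Fin K → ℕ
    summand = _
    vertex≡ : vertex ε ≡ (c + sum (map summand (allFin K))) mod M
    vertex≡ = refl
    r∣summand : ∀ j → r ∣ summand j
    r∣summand j with ε j
    ... | true  = subst (r ∣_) (sym (+-identityʳ _)) (∣n⇒∣m*n (ρ j) (r∣M/p j))
    ... | false = r ∣0

  gcd-vertex-spread : ∀ {i β} ε₀ → suc β < n i → gcd (vertex ε₀) (p i ^ n i) ≡ p i ^ β →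
                      ∀ ε → gcd (vertex ε) (p i ^ n i) ≡ p i ^ β
  gcd-vertex-spread {i} {β} ε₀ 1+β<n gcd₀≡p^β ε =
    gcd[x,p^[1+β]]≡p^β⇒gcd[x,p^n]≡p^β (p-prime i) (vertex ε) (<-trans (n<1+n β) 1+β<n) (begin
      gcd (vertex ε) r            ≡⟨ gcd-vertex≡gcd-c r∣M r∣M/p ε ⟩
      gcd c r                     ≡⟨ gcd-vertex≡gcd-c r∣M r∣M/p ε₀ ⟨
      gcd (vertex ε₀) r           ≡⟨ gcd[x,n]∣m⇒gcd[x,m]≡gcd[x,n] (vertex ε₀) r∣p^n gcd₀∣r ⟩
      gcd (vertex ε₀) (p i ^ n i) ≡⟨ gcd₀≡p^β ⟩
      p i ^ β                     ∎)
    where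
    open ≡-Reasoning
    r : ℕ
    r = p i ^ suc β
    r∣p^n : r ∣ p i ^ n i
    r∣p^n = ^-monoʳ-∣ (p i) (<⇒≤ 1+β<n)
    r∣M : r ∣ M
    r∣M = ∣-trans r∣p^n (p^n∣M i)
    r∣M/p : ∀ j → r ∣ M div p j
    r∣M/p = p^k∣M-div-p 1+β<n
    gcd₀∣r : gcd (vertex ε₀) (p i ^ n i) ∣ r
    gcd₀∣r = subst (_∣ r) (sym gcd₀≡p^β) (^-monoʳ-∣ (p i) (n≤1+n β))

lemma3p3 : {A : Set} (K : ℕ) (P : PrimeData K) (Δ : Cuboid P) (f : ℕ → A) →
    IsStep (PrimeData.M P) f →
    ((i : Fin K) (β : ℕ) → β + 1 ≤ PrimeData.n P i →
      ((ε : Fin K → Bool) → gcd (Cuboid.vertex Δ ε) (PrimeData.p P i ^ PrimeData.n P i) ≡ PrimeData.p P i ^ β) →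
      (ε ε' : Fin K → Bool) →
      gcd (diffMod (PrimeData.M P) (Cuboid.vertex Δ ε) (Cuboid.vertex Δ ε')) (PrimeData.M P) ≡ PrimeData.M P div PrimeData.p P i →
      f (Cuboid.vertex Δ ε) ≡ f (Cuboid.vertex Δ ε'))
    ×
    ((i : Fin K) (β : ℕ) (ε₀ : Fin K → Bool) → β + 2 ≤ PrimeData.n P i →
      gcd (Cuboid.vertex Δ ε₀) (PrimeData.p P i ^ PrimeData.n P i) ≡ PrimeData.p P i ^ β →
      ((ε : Fin K → Bool) → gcd (Cuboid.vertex Δ ε) (PrimeData.p P i ^ PrimeData.n P i) ≡ PrimeData.p P i ^ β)
      ×
      ((ε ε' : Fin K → Bool) →
        gcd (diffMod (PrimeData.M P) (Cuboid.vertex Δ ε) (Cuboid.vertex Δ ε')) (PrimeData.M P) ≡ PrimeData.M P div PrimeData.p P i →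
        f (Cuboid.vertex Δ ε) ≡ f (Cuboid.vertex Δ ε')))
lemma3p3 K P Δ f f-step =
  (λ i β _ → f-vertex-cong i) ,
  (λ i β ε₀ β+2≤n gcd₀≡p^β →
    let spread : ∀ ε → gcd (vertex ε) (p i ^ n i) ≡ p i ^ β
        spread = gcd-vertex-spread ε₀ (subst (_≤ n i) (+-comm β 2) β+2≤n) gcd₀≡p^β
    in spread , f-vertex-cong i spread)
  where
  open PrimeData P
  open Cuboid Δ
  open PrimeDataProperties P
  open CuboidProperties Δ
  f-vertex-cong : ∀ i {g} → (∀ ε → gcd (vertex ε) (p i ^ n i) ≡ g) →
                  ∀ ε ε' → gcd (diffMod M (vertex ε) (vertex ε')) M ≡ M div p i →
                  f (vertex ε) ≡ f (vertex ε')
  f-vertex-cong i gcd≡g ε ε' gcd[diff,M]≡M/p =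
    f-step (vertex ε) (vertex ε') (vertex<M ε) (vertex<M ε')
      (gcd-M-cong (≤-trans (<⇒≤ (vertex<M ε')) (m≤n+m M (vertex ε)))
                  (trans (gcd≡g ε) (sym (gcd≡g ε')))
                  (subst (_∣ diffMod M (vertex ε) (vertex ε')) gcd[diff,M]≡M/p (gcd[m,n]∣m _ M)))
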